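{- Let $k\ge2$ and $n\in\mathbb{N}$. The set of possible descents of stable configurations $\mathcal{C}_{k,n,w}$, $w\in S_n$ (that is, the union over $w\in S_n$ of the descent sets of $\mathcal{C}_{k,n,w}$), is $\{k,2k,\dots,k^n-k\}$.
   Context: The infinite rooted directed $k$-ary tree has a root on layer $1$; every vertex has $k$ children, ordered left to right, on the next layer. A vertex with at least $k$ chips may fire by choosing $k$ of its labeled chips and sending the $j$th smallest to its $j$th leftmost child. Chips $0,\dots,k^n-1$ start at the root and are written in $n$-digit $k$-ary expansion. For $w\in S_n$, the strategy $F_w$ fires, for each $i\in[n]$, each vertex $v$ on layer $i$ so that all chips on $v$ whose $w_i$th most significant digit equals $j$ go to the $(j+1)$th leftmost child of $v$. $\mathcal{C}_{k,n,w}=(\pi_1,\dots,\pi_{k^n})$ is the resulting stable configuration, read as the sequence of chips on layer $n+1$ from left to right; its descent set is $\{i\in[k^n-1]:\pi_i>\pi_{i+1}\}$. -}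

module Defs where

open import Data.Nat using (ℕ; zero; suc; _+_; _*_; _∸_; _^_; _≤_; _<_; _≟_)
open import Data.Nat.DivMod using (_/_; _%_)
open import Data.Nat.Properties using (m^n≢0)
open import Data.Fin using (Fin; toℕ)
open import Data.Fin.Permutation using (Permutation′; _⟨$⟩ʳ_)
open import Data.List using (List; []; _∷_; map; concat; concatMap; filter; upTo; allFin)
open import Data.Maybe using (Maybe; just; nothing)
open import Data.Product using (Σ; ∃; _×_)

Sym : ℕ → Set
Sym n = Permutation′ n

-- the (d+1)-th most significant digit (d : Fin n, 0-indexed) of chip c
-- in its n-digit base-k expansion, i.e. ⌊c / k^(n-d-1)⌋ mod k.
-- (k = 0 is a junk case, never used since k ≥ 2.)
digit : (k n : ℕ) → Fin n → ℕ → ℕ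
digit zero    n d c = 0
digit (suc k) n d c = _%_ (_/_ c (suc k ^ (n ∸ suc (toℕ d))) {{m^n≢0 (suc k) (n ∸ suc (toℕ d))}}) (suc k)

-- a layer configuration: the chip multisets on the vertices of a layer,
-- listed left to right
Layer : Set
Layer = List (List ℕ)

fireVertex : (k n : ℕ) → Fin n → List ℕ → Layer
fireVertex k n d chips = map (λ j → filter (λ c → digit k n d c ≟ j) chips) (upTo k)

fireLayer : (k n : ℕ) → Fin n → Layer → Layer
fireLayer k n d L = concatMap (fireVertex k n d) L

runLayers : (k n : ℕ) → List (Fin n) → Layer → Layer
runLayers k n []       L = L
runLayers k n (d ∷ ds) L = runLayers k n ds (fireLayer k n d L)

-- the stable configuration C_{k,n,w}: chips on layer n+1, read left to right
-- (the layer at step i fires by the w_i-th most significant digit)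
config : (k n : ℕ) → Sym n → List ℕ
config k n w = concat (runLayers k n (map (w ⟨$⟩ʳ_) (allFin n)) ((upTo (k ^ n)) ∷ []))

nth : List ℕ → ℕ → Maybe ℕ
nth []       _       = nothing
nth (x ∷ xs) zero    = just x
nth (x ∷ xs) (suc i) = nth xs i

-- i is a descent of π = (π_1,...,π_N) (1-indexed): 1 ≤ i ≤ N-1 and π_i > π_{i+1}
-- i.e. with 0-indexed lookup: π[i-1] > π[i]
IsDescent : List ℕ → ℕ → Set
IsDescent π zero    = Data.Empty.⊥
  where import Data.Empty
IsDescent π (suc i) = Σ ℕ λ a → Σ ℕ λ b →
  (nth π i ≡ just a) × (nth π (suc i) ≡ just b) × (b < a)
  where open import Relation.Binary.PropositionalEquality using (_≡_)

-- After the first n − 1 firings, a vertex on layer n holds exactly the chips with prescribed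
-- digits in the positions fired so far: the k chips a + j·k^e (j < k), where k^e is the place
-- value of the digit fired last. The last firing lays them out in increasing order, so
-- C_{k,n,w} is a concatenation of k^(n−1) increasing blocks of length k, and a descent can only
-- sit at a block boundary m·k with 1 ≤ m < k^(n−1). Conversely, if the last fired digit is the
-- most significant one (w = reverse), every block starts below k^(n−1) and ends at or above
-- (k−1)·k^(n−1) ≥ k^(n−1), so every boundary is a descent.

{-# OPTIONS --safe #-}
module Submission where

open import Defs
open import Data.Nat using (ℕ; _*_; _∸_; _^_; _≤_)
open import Data.Product using (Σ; _×_)
open import Function.Bundles using (_⇔_)
open import Relation.Binary.PropositionalEquality using (_≡_)

open import Data.Bool using (true; false)
open import Data.Empty using (⊥-elim)
open import Data.Fin as Fin using (Fin; toℕ; fromℕ; fromℕ<; inject₁; lower₁; opposite)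
open import Data.Fin.Properties
  using (toℕ-injective; toℕ<n; toℕ-fromℕ; toℕ-fromℕ<; opposite-prop; opposite-involutive;
         inject₁-injective; inject₁-lower₁; fromℕ≢inject₁)
open import Data.Fin.Permutation using (_⟨$⟩ʳ_; _⟨$⟩ˡ_; inverseʳ; reverse)
open import Data.List
  using (List; []; _∷_; _++_; _∷ʳ_; [_]; map; concat; concatMap; filter; length; upTo; applyUpTo; tabulate)
open import Data.List.Properties
  using (length-++; length-map; length-upTo; length-applyUpTo; length-tabulate; ++-identityʳ;
         map-∘; map-cong; map-cong-local; map-upTo; map-tabulate; map-concatMap; concatMap-cong;
         concatMap-++; concat-concat; concat-map-[_]; upTo-∷ʳ;
         filter-all; filter-none; filter-accept; filter-reject; filter-++; filter-≐)
open import Data.List.Membership.Propositional using (_∈_)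
open import Data.List.Membership.Propositional.Properties using (∈-upTo⁻; ∈-tabulate⁺)
open import Data.List.Relation.Binary.Pointwise using (Pointwise; []; _∷_)
import Data.List.Relation.Binary.Pointwise as Pointwise
open import Data.List.Relation.Unary.All using (All; []; _∷_)
import Data.List.Relation.Unary.All as All
import Data.List.Relation.Unary.All.Properties as All
open import Data.List.Relation.Unary.AllPairs using ([]; _∷_)
import Data.List.Relation.Unary.AllPairs as AllPairs
open import Data.List.Relation.Unary.Any using (here; there)
open import Data.List.Relation.Unary.Unique.Propositional using (Unique)
import Data.List.Relation.Unary.Unique.Propositional.Properties as Unique
open import Data.Maybe using (just)
open import Data.Maybe.Properties using (just-injective)
open import Data.Nat
  using (zero; suc; _+_; _<_; _≟_; NonZero; >-nonZero; z≤n; s≤s; z<s; s<s)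
open import Data.Nat.DivMod
  using (_/_; _%_; m≡m%n+[m/n]*n; m%n<n; m%n%n≡m%n; %-distribˡ-+; [m+kn]%n≡m%n; m<n⇒m%n≡m;
         n/1≡n; 0/n≡0; m*n/n≡m; m<n⇒m/n≡0; m/n≡0⇒m<n; +-distrib-/; +-distrib-/-∣ʳ;
         m<n*o⇒m/o<n; m/n/o≡m/[n*o])
open import Data.Nat.Divisibility using (divides)
open import Data.Nat.Properties
open import Data.Product using (_,_; uncurry)
open import Data.Sum using (_⊎_; inj₁; inj₂)
open import Function using (id; _∘_; _∘′_; mk⇔; Injection)
open import Function.Properties.Inverse using (↔⇒↣)
open import Relation.Binary.Definitions using (tri<; tri≈; tri>)
open import Relation.Binary.PropositionalEquality
  using (_≢_; refl; sym; trans; cong; cong₂; subst; module ≡-Reasoning)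
open import Relation.Nullary using (¬_; does; yes; no; contradiction)
open import Relation.Unary using (Pred; Decidable)
open import Relation.Unary.Properties using (_∩?_)

filter-filter : ∀ {a p q} {A : Set a} {P : Pred A p} {Q : Pred A q} (P? : Decidable P) (Q? : Decidable Q) →
                ∀ xs → filter P? (filter Q? xs) ≡ filter (Q? ∩? P?) xs
filter-filter P? Q? [] = refl
filter-filter P? Q? (x ∷ xs) with does (Q? x)
... | false = filter-filter P? Q? xs
... | true with does (P? x)
...   | false = filter-filter P? Q? xs
...   | true  = cong (x ∷_) (filter-filter P? Q? xs)

filter-upTo-unique : ∀ {p} {P : Pred ℕ p} (P? : Decidable P) {N c} → c < N → P c →
                     (∀ {y} → y < N → P y → y ≡ c) → filter P? (upTo N) ≡ c ∷ []
filter-upTo-unique P? {suc N} {c} c<1+N Pc unique = begin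
  filter P? (upTo (suc N))                 ≡⟨ cong (filter P?) (upTo-∷ʳ N) ⟨
  filter P? (upTo N ++ N ∷ [])             ≡⟨ filter-++ P? (upTo N) (N ∷ []) ⟩
  filter P? (upTo N) ++ filter P? (N ∷ []) ≡⟨ before-or-last (m<1+n⇒m<n∨m≡n c<1+N) ⟩
  c ∷ []                                   ∎
  where
  open ≡-Reasoning
  before-or-last : c < N ⊎ c ≡ N → filter P? (upTo N) ++ filter P? (N ∷ []) ≡ c ∷ []
  before-or-last (inj₁ c<N) = cong₂ _++_
    (filter-upTo-unique P? c<N Pc (unique ∘ m<n⇒m<1+n))
    (filter-reject P? λ PN → <-irrefl (sym (unique ≤-refl PN)) c<N)
  before-or-last (inj₂ refl) = cong₂ _++_
    (filter-none P? (All.tabulate λ y∈ Py → <-irrefl (unique (m<n⇒m<1+n (∈-upTo⁻ y∈)) Py) (∈-upTo⁻ y∈)))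
    (filter-accept P? Pc)

length-concatMap-const : ∀ {a b} {A : Set a} {B : Set b} {f : A → List B} {c} → (∀ x → length (f x) ≡ c) →
                         ∀ xs → length (concatMap f xs) ≡ length xs * c
length-concatMap-const         f-len []       = refl
length-concatMap-const {f = f} f-len (x ∷ xs) =
  trans (length-++ (f x)) (cong₂ _+_ (f-len x) (length-concatMap-const f-len xs))

module Digits (k′ : ℕ) where

  k : ℕ
  k = suc k′

  -- Defs.digit k n d is definitionally digitAt (place d), with place defined further down.
  digitAt : ℕ → ℕ → ℕ
  digitAt s c = (_/_ c (k ^ s) {{m^n≢0 k s}}) % k

  digitAt-lowest : ∀ c → digitAt 0 c ≡ c % k
  digitAt-lowest c = cong (_% k) (n/1≡n c)

  digitAt-suc : ∀ s c → digitAt (suc s) c ≡ digitAt s (c / k)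
  digitAt-suc s c = cong (_% k) (sym (m/n/o≡m/[n*o] c k (k ^ s) {{_}} {{m^n≢0 k s}} {{m^n≢0 k (suc s)}}))

  digitAt-0≡0 : ∀ s → digitAt s 0 ≡ 0
  digitAt-0≡0 s = cong (_% k) (0/n≡0 (k ^ s) {{m^n≢0 k s}})

  c<k^1+n⇒c/k<k^n : ∀ {c} n → c < k ^ suc n → c / k < k ^ n
  c<k^1+n⇒c/k<k^n {c} n c< = m<n*o⇒m/o<n (subst (c <_) (*-comm k (k ^ n)) c<)

  c/k<k^n⇒c<k^1+n : ∀ {c} n → c / k < k ^ n → c < k ^ suc n
  c/k<k^n⇒c<k^1+n {c} n c/k< = begin-strict
    c                 ≡⟨ m≡m%n+[m/n]*n c k ⟩
    c % k + c / k * k <⟨ +-monoˡ-< (c / k * k) (m%n<n c k) ⟩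
    suc (c / k) * k   ≤⟨ *-monoˡ-≤ k c/k< ⟩
    k ^ n * k         ≡⟨ *-comm (k ^ n) k ⟩
    k ^ suc n         ∎
    where open ≤-Reasoning

  digitAt-injective : ∀ n {c c′} → c < k ^ n → c′ < k ^ n →
                      (∀ s → s < n → digitAt s c ≡ digitAt s c′) → c ≡ c′
  digitAt-injective zero    (s≤s z≤n) (s≤s z≤n) _ = refl
  digitAt-injective (suc n) {c} {c′} c< c′< same = begin
    c                   ≡⟨ m≡m%n+[m/n]*n c k ⟩
    c % k + c / k * k   ≡⟨ cong₂ (λ r q → r + q * k) same-lowest same-rest ⟩
    c′ % k + c′ / k * k ≡⟨ m≡m%n+[m/n]*n c′ k ⟨
    c′                  ∎
    where
    open ≡-Reasoning
    same-lowest : c % k ≡ c′ % k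
    same-lowest = trans (sym (digitAt-lowest c)) (trans (same 0 z<s) (digitAt-lowest c′))
    same-rest : c / k ≡ c′ / k
    same-rest = digitAt-injective n (c<k^1+n⇒c/k<k^n n c<) (c<k^1+n⇒c/k<k^n n c′<) λ s s<n →
      trans (sym (digitAt-suc s c)) (trans (same (suc s) (s<s s<n)) (digitAt-suc s c′))

  private
    j*k^1+e≡j*k^e*k : ∀ j e → j * k ^ suc e ≡ j * k ^ e * k
    j*k^1+e≡j*k^e*k j e = trans (cong (j *_) (*-comm k (k ^ e))) (sym (*-assoc j (k ^ e) k))

    [c+j*k^1+e]/k≡c/k+j*k^e : ∀ c j e → (c + j * k ^ suc e) / k ≡ c / k + j * k ^ e
    [c+j*k^1+e]/k≡c/k+j*k^e c j e = begin
      (c + j * k ^ suc e) / k   ≡⟨ cong (λ x → (c + x) / k) (j*k^1+e≡j*k^e*k j e) ⟩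
      (c + j * k ^ e * k) / k   ≡⟨ +-distrib-/-∣ʳ c (divides (j * k ^ e) refl) ⟩
      c / k + j * k ^ e * k / k ≡⟨ cong (c / k +_) (m*n/n≡m (j * k ^ e) k) ⟩
      c / k + j * k ^ e         ∎
      where open ≡-Reasoning

    digitAt-suc-+ : ∀ s c j e → digitAt (suc s) (c + j * k ^ suc e) ≡ digitAt s (c / k + j * k ^ e)
    digitAt-suc-+ s c j e =
      trans (digitAt-suc s (c + j * k ^ suc e)) (cong (digitAt s) ([c+j*k^1+e]/k≡c/k+j*k^e c j e))

    j*1<k : ∀ {j} → j < k → j * 1 < k
    j*1<k {j} = subst (_< k) (sym (*-identityʳ j))

    [c+j]/k≡c/k : ∀ c j → c % k ≡ 0 → j < k → (c + j * 1) / k ≡ c / k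
    [c+j]/k≡c/k c j c%k≡0 j<k = begin
      (c + j * 1) / k   ≡⟨ +-distrib-/ c (j * 1) no-carry ⟩
      c / k + j * 1 / k ≡⟨ cong (c / k +_) (m<n⇒m/n≡0 (j*1<k j<k)) ⟩
      c / k + 0         ≡⟨ +-identityʳ (c / k) ⟩
      c / k             ∎
      where
      open ≡-Reasoning
      no-carry : c % k + j * 1 % k < k
      no-carry = subst (_< k) (cong (_+ j * 1 % k) (sym c%k≡0)) (m%n<n (j * 1) k)

    [c+j]%k≡j : ∀ c j → c % k ≡ 0 → j < k → (c + j * 1) % k ≡ j
    [c+j]%k≡j c j c%k≡0 j<k = begin
      (c + j * 1) % k         ≡⟨ %-distribˡ-+ c (j * 1) k ⟩
      (c % k + j * 1 % k) % k ≡⟨ cong (λ r → (r + j * 1 % k) % k) c%k≡0 ⟩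
      j * 1 % k % k           ≡⟨ m%n%n≡m%n (j * 1) k ⟩
      j * 1 % k               ≡⟨ m<n⇒m%n≡m (j*1<k j<k) ⟩
      j * 1                   ≡⟨ *-identityʳ j ⟩
      j                       ∎
      where open ≡-Reasoning

    lowest≡0 : ∀ c → digitAt 0 c ≡ 0 → c % k ≡ 0
    lowest≡0 c = trans (sym (digitAt-lowest c))

    next≡0 : ∀ e c → digitAt (suc e) c ≡ 0 → digitAt e (c / k) ≡ 0
    next≡0 e c = trans (sym (digitAt-suc e c))

  digitAt-+-same : ∀ e c j → digitAt e c ≡ 0 → j < k → digitAt e (c + j * k ^ e) ≡ j
  digitAt-+-same zero    c j c₀≡0 j<k =
    trans (digitAt-lowest (c + j * 1)) ([c+j]%k≡j c j (lowest≡0 c c₀≡0) j<k)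
  digitAt-+-same (suc e) c j cₑ≡0 j<k =
    trans (digitAt-suc-+ e c j e) (digitAt-+-same e (c / k) j (next≡0 e c cₑ≡0) j<k)

  digitAt-+-other : ∀ e s c j → digitAt e c ≡ 0 → j < k → s ≢ e →
                    digitAt s (c + j * k ^ e) ≡ digitAt s c
  digitAt-+-other zero    zero    c j _    _   s≢e = contradiction refl s≢e
  digitAt-+-other zero    (suc s) c j c₀≡0 j<k _   = begin
    digitAt (suc s) (c + j * 1)   ≡⟨ digitAt-suc s (c + j * 1) ⟩
    digitAt s ((c + j * 1) / k)   ≡⟨ cong (digitAt s) ([c+j]/k≡c/k c j (lowest≡0 c c₀≡0) j<k) ⟩
    digitAt s (c / k)             ≡⟨ digitAt-suc s c ⟨
    digitAt (suc s) c             ∎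
    where open ≡-Reasoning
  digitAt-+-other (suc e) zero    c j _    _   _   = begin
    digitAt 0 (c + j * k ^ suc e) ≡⟨ digitAt-lowest (c + j * k ^ suc e) ⟩
    (c + j * k ^ suc e) % k       ≡⟨ cong (λ x → (c + x) % k) (j*k^1+e≡j*k^e*k j e) ⟩
    (c + j * k ^ e * k) % k       ≡⟨ [m+kn]%n≡m%n c (j * k ^ e) k ⟩
    c % k                         ≡⟨ digitAt-lowest c ⟨
    digitAt 0 c                   ∎
    where open ≡-Reasoning
  digitAt-+-other (suc e) (suc s) c j cₑ≡0 j<k s≢e = begin
    digitAt (suc s) (c + j * k ^ suc e)
      ≡⟨ digitAt-suc-+ s c j e ⟩
    digitAt s (c / k + j * k ^ e)
      ≡⟨ digitAt-+-other e s (c / k) j (next≡0 e c cₑ≡0) j<k (s≢e ∘′ cong suc) ⟩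
    digitAt s (c / k)
      ≡⟨ digitAt-suc s c ⟨
    digitAt (suc s) c
      ∎
    where open ≡-Reasoning

  c+j*k^e<k^n : ∀ n e {c} j → c < k ^ n → digitAt e c ≡ 0 → e < n → j < k → c + j * k ^ e < k ^ n
  c+j*k^e<k^n (suc n) zero    {c} j c< c₀≡0 _ j<k = c/k<k^n⇒c<k^1+n n
    (subst (_< k ^ n) (sym ([c+j]/k≡c/k c j (lowest≡0 c c₀≡0) j<k)) (c<k^1+n⇒c/k<k^n n c<))
  c+j*k^e<k^n (suc n) (suc e) {c} j c< cₑ≡0 (s<s e<n) j<k = c/k<k^n⇒c<k^1+n n
    (subst (_< k ^ n) (sym ([c+j*k^1+e]/k≡c/k+j*k^e c j e))
      (c+j*k^e<k^n n e j (c<k^1+n⇒c/k<k^n n c<) (next≡0 e c cₑ≡0) e<n j<k))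

  top-digitAt≡0⇒c<k^n : ∀ n {c} → c < k ^ suc n → digitAt n c ≡ 0 → c < k ^ n
  top-digitAt≡0⇒c<k^n n {c} c< cₙ≡0 =
    m/n≡0⇒m<n {{m^n≢0 k n}} (trans (sym (m<n⇒m%n≡m (m<n*o⇒m/o<n {{m^n≢0 k n}} c<))) cₙ≡0)

module Layers (k n : ℕ) where

  HasDigits : List (Fin n) → List ℕ → ℕ → Set
  HasDigits ds js c = Pointwise (λ d j → digit k n d c ≡ j) ds js

  hasDigits? : ∀ ds js → Decidable (HasDigits ds js)
  hasDigits? ds js c = Pointwise.decidable (λ d j → digit k n d c ≟ j) ds js

  DigitString : List (Fin n) → List ℕ → Set
  DigitString = Pointwise (λ _ j → j < k)

  digitStrings : ℕ → List (List ℕ)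
  digitStrings zero    = [] ∷ []
  digitStrings (suc r) = concatMap (λ j → map (j ∷_) (digitStrings r)) (upTo k)

  digitStrings-valid : ∀ ds → All (DigitString ds) (digitStrings (length ds))
  digitStrings-valid []       = [] ∷ []
  digitStrings-valid (d ∷ ds) = All.concat⁺ (All.map⁺ (All.tabulate λ j∈ →
    All.map⁺ (All.map (∈-upTo⁻ j∈ ∷_) (digitStrings-valid ds))))

  length-digitStrings : ∀ r → length (digitStrings r) ≡ k ^ r
  length-digitStrings zero    = refl
  length-digitStrings (suc r) = trans
    (length-concatMap-const (λ j → trans (length-map (j ∷_) (digitStrings r)) (length-digitStrings r)) (upTo k))
    (cong (_* k ^ r) (length-upTo k))

  runLayers-[] : ∀ ds → runLayers k n ds [] ≡ []
  runLayers-[] []       = refl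
  runLayers-[] (d ∷ ds) = runLayers-[] ds

  runLayers-++ : ∀ ds L L′ → runLayers k n ds (L ++ L′) ≡ runLayers k n ds L ++ runLayers k n ds L′
  runLayers-++ []       L L′ = refl
  runLayers-++ (d ∷ ds) L L′ =
    trans (cong (runLayers k n ds) (concatMap-++ (fireVertex k n d) L L′))
          (runLayers-++ ds (fireLayer k n d L) (fireLayer k n d L′))

  runLayers-map : ∀ {A : Set} ds (f : A → List ℕ) xs →
                  runLayers k n ds (map f xs) ≡ concatMap (λ x → runLayers k n ds (f x ∷ [])) xs
  runLayers-map ds f []       = runLayers-[] ds
  runLayers-map ds f (x ∷ xs) =
    trans (runLayers-++ ds (f x ∷ []) (map f xs)) (cong (runLayers k n ds (f x ∷ []) ++_) (runLayers-map ds f xs))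

  runLayers-∷ʳ : ∀ ds d L → runLayers k n (ds ∷ʳ d) L ≡ fireLayer k n d (runLayers k n ds L)
  runLayers-∷ʳ []        d L = refl
  runLayers-∷ʳ (d′ ∷ ds) d L = runLayers-∷ʳ ds d (fireLayer k n d′ L)

  filter-digit-hasDigits : ∀ d j ds js xs →
    filter (hasDigits? ds js) (filter (λ c → digit k n d c ≟ j) xs) ≡ filter (hasDigits? (d ∷ ds) (j ∷ js)) xs
  filter-digit-hasDigits d j ds js xs = trans (filter-filter (hasDigits? ds js) (λ c → digit k n d c ≟ j) xs)
                                              (filter-≐ _ _ (uncurry _∷_ , Pointwise.uncons) xs)

  filter-hasDigits-digit : ∀ d j ds js xs →
    filter (λ c → digit k n d c ≟ j) (filter (hasDigits? ds js) xs) ≡ filter (hasDigits? (d ∷ ds) (j ∷ js)) xs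
  filter-hasDigits-digit d j ds js xs = trans (filter-filter (λ c → digit k n d c ≟ j) (hasDigits? ds js) xs)
                                              (filter-≐ _ _ ((λ (h , e) → e ∷ h) , λ { (e ∷ h) → h , e }) xs)

  runLayers-single-vertex : ∀ ds xs → runLayers k n ds (xs ∷ []) ≡
                            map (λ js → filter (hasDigits? ds js) xs) (digitStrings (length ds))
  runLayers-single-vertex []       xs = sym (cong (_∷ []) (filter-all (hasDigits? [] []) (All.universal (λ _ → []) xs)))
  runLayers-single-vertex (d ∷ ds) xs = begin
    runLayers k n ds (fireVertex k n d xs ++ [])
      ≡⟨ cong (runLayers k n ds) (++-identityʳ (fireVertex k n d xs)) ⟩
    runLayers k n ds (map child (upTo k))
      ≡⟨ runLayers-map ds child (upTo k) ⟩
    concatMap (λ j → runLayers k n ds (child j ∷ [])) (upTo k)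
      ≡⟨ concatMap-cong (λ j → trans (runLayers-single-vertex ds (child j))
                                     (map-cong (λ js → filter-digit-hasDigits d j ds js xs) strings)) (upTo k) ⟩
    concatMap (λ j → map (λ js → filter (hasDigits? (d ∷ ds) (j ∷ js)) xs) strings) (upTo k)
      ≡⟨ concatMap-cong (λ j → map-∘ strings) (upTo k) ⟩
    concatMap (λ j → map (λ js → filter (hasDigits? (d ∷ ds) js) xs) (map (j ∷_) strings)) (upTo k)
      ≡⟨ map-concatMap (λ js → filter (hasDigits? (d ∷ ds) js) xs) _ (upTo k) ⟨
    map (λ js → filter (hasDigits? (d ∷ ds) js) xs) (digitStrings (suc (length ds)))
      ∎
    where
    open ≡-Reasoning
    strings = digitStrings (length ds)
    child : ℕ → List ℕ
    child j = filter (λ c → digit k n d c ≟ j) xs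

nth-++ˡ : ∀ xs {ys i} → i < length xs → nth (xs ++ ys) i ≡ nth xs i
nth-++ˡ (x ∷ xs) {i = zero}  _         = refl
nth-++ˡ (x ∷ xs) {i = suc i} (s<s i<n) = nth-++ˡ xs i<n

nth-++ʳ : ∀ xs {ys} i → nth (xs ++ ys) (length xs + i) ≡ nth ys i
nth-++ʳ []       i = refl
nth-++ʳ (x ∷ xs) i = nth-++ʳ xs i

nth-applyUpTo : ∀ (f : ℕ → ℕ) {N t} → t < N → nth (applyUpTo f N) t ≡ just (f t)
nth-applyUpTo f {suc N} {zero}  _         = refl
nth-applyUpTo f {suc N} {suc t} (s<s t<N) = nth-applyUpTo (f ∘′ suc) t<N

isDescent-transport : ∀ π π′ {i j} → nth π i ≡ nth π′ j → nth π (suc i) ≡ nth π′ (suc j) →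
                      IsDescent π (suc i) → IsDescent π′ (suc j)
isDescent-transport π π′ eq eq′ (a , b , πᵢ≡a , πᵢ₊₁≡b , b<a) =
  a , b , trans (sym eq) πᵢ≡a , trans (sym eq′) πᵢ₊₁≡b , b<a

module BlockDescents (k′ step : ℕ) where

  k : ℕ
  k = suc k′

  block : ℕ → List ℕ
  block a = applyUpTo (λ j → a + j * step) k

  length-block : ∀ a → length (block a) ≡ k
  length-block a = length-applyUpTo (λ j → a + j * step) k

  nth-block-++ : ∀ a L {r} → r < k → nth (block a ++ L) r ≡ just (a + r * step)
  nth-block-++ a L {r} r<k =
    trans (nth-++ˡ (block a) (subst (r <_) (sym (length-block a)) r<k)) (nth-applyUpTo (λ j → a + j * step) r<k)

  nth-block-++-after : ∀ a L i → nth (block a ++ L) (k + i) ≡ nth L i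
  nth-block-++-after a L i =
    trans (cong (λ l → nth (block a ++ L) (l + i)) (sym (length-block a))) (nth-++ʳ (block a) i)

  isDescent-block-++⁺ : ∀ a L i → IsDescent L i → IsDescent (block a ++ L) (k + i)
  isDescent-block-++⁺ a L (suc i) = isDescent-transport L (block a ++ L)
    (sym (trans (cong (nth (block a ++ L)) (+-suc k′ i)) (nth-block-++-after a L i)))
    (sym (nth-block-++-after a L (suc i)))

  isDescent-block-++⁻ : ∀ a L i → IsDescent (block a ++ L) (k + suc i) → IsDescent L (suc i)
  isDescent-block-++⁻ a L i = isDescent-transport (block a ++ L) L
    (trans (cong (nth (block a ++ L)) (+-suc k′ i)) (nth-block-++-after a L i))
    (nth-block-++-after a L (suc i))

  no-descent-inside-block : ∀ a L {i} → suc i < k → ¬ IsDescent (block a ++ L) (suc i)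
  no-descent-inside-block a L {i} 1+i<k (x , y , πᵢ≡x , πᵢ₊₁≡y , y<x) = <⇒≱ y<x (begin
    x                  ≡⟨ just-injective (trans (sym πᵢ≡x) (nth-block-++ a L (<⇒≤ 1+i<k))) ⟩
    a + i * step       ≤⟨ +-monoʳ-≤ a (*-monoˡ-≤ step (n≤1+n i)) ⟩
    a + suc i * step   ≡⟨ just-injective (trans (sym (nth-block-++ a L 1+i<k)) πᵢ₊₁≡y) ⟩
    y                  ∎)
    where open ≤-Reasoning

  1+i≡k+[1+[i∸k]] : ∀ {i} → k < suc i → suc i ≡ k + suc (i ∸ k)
  1+i≡k+[1+[i∸k]] {i} k<1+i = trans (cong suc (sym (m+[n∸m]≡n (m<1+n⇒m≤n k<1+i)))) (sym (+-suc k (i ∸ k)))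

  descent⇒block-boundary : ∀ as i → IsDescent (concat (map block as)) i →
                           Σ ℕ λ m → 1 ≤ m × m < length as × i ≡ m * k
  descent⇒block-boundary []       (suc i) (_ , _ , () , _)
  descent⇒block-boundary (a ∷ as) (suc i) desc with <-cmp (suc i) k
  ... | tri< 1+i<k _ _ = ⊥-elim (no-descent-inside-block a _ 1+i<k desc)
  ... | tri≈ _ 1+i≡k _ = 1 , ≤-refl , not-last-block as desc , trans 1+i≡k (sym (*-identityˡ k))
    where
    not-last-block : ∀ bs → IsDescent (block a ++ concat (map block bs)) (suc i) → 1 < length (a ∷ bs)
    not-last-block []      (_ , _ , _ , πᵢ₊₁≡y , _) = contradiction
      (trans (sym πᵢ₊₁≡y) (trans (cong (nth (block a ++ [])) (trans 1+i≡k (sym (+-identityʳ k))))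
                                 (nth-block-++-after a [] 0)))
      λ ()
    not-last-block (_ ∷ _) _ = s<s (s<s z≤n)
  ... | tri> _ _ k<1+i
    with m , 1≤m , m<len , eq ← descent⇒block-boundary as (suc (i ∸ k))
           (isDescent-block-++⁻ a (concat (map block as)) (i ∸ k)
             (subst (IsDescent (block a ++ concat (map block as))) (1+i≡k+[1+[i∸k]] k<1+i) desc))
    = suc m , s≤s z≤n , s<s m<len , trans (1+i≡k+[1+[i∸k]] k<1+i) (cong (k +_) eq)

  block-boundary⇒descent : 1 ≤ k′ → ∀ as m → All (_< step) as → 1 ≤ m → m < length as →
                           IsDescent (concat (map block as)) (m * k)
  block-boundary⇒descent 1≤k′ (a ∷ b ∷ as) 1 (_ ∷ b<step ∷ _) _ _ =
    a + (k′ + 0) * step , b + 0 * step ,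
    nth-block-++ a L (s≤s (≤-reflexive (+-identityʳ k′))) ,
    trans (nth-block-++-after a L 0) (nth-block-++ b (concat (map block as)) z<s) ,
    b<a
    where
    L = concat (map block (b ∷ as))
    b<a : b + 0 * step < a + (k′ + 0) * step
    b<a = begin-strict
      b + 0 * step        ≡⟨ +-identityʳ b ⟩
      b                   <⟨ b<step ⟩
      step                ≡⟨ *-identityˡ step ⟨
      1 * step            ≤⟨ *-monoˡ-≤ step (≤-trans 1≤k′ (m≤m+n k′ 0)) ⟩
      (k′ + 0) * step     ≤⟨ m≤n+m ((k′ + 0) * step) a ⟩
      a + (k′ + 0) * step ∎
      where open ≤-Reasoning
  block-boundary⇒descent 1≤k′ (a ∷ as) (suc (suc m)) (_ ∷ as<step) _ (s<s m<len) =
    isDescent-block-++⁺ a _ (suc m * k) (block-boundary⇒descent 1≤k′ as (suc m) as<step (s≤s z≤n) m<len)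

place : ∀ {n} → Fin n → ℕ
place {n} d = n ∸ suc (toℕ d)

place≡toℕ-opposite : ∀ {n} (d : Fin n) → place d ≡ toℕ (opposite d)
place≡toℕ-opposite d = sym (opposite-prop d)

place-< : ∀ {n} (d : Fin n) → place d < n
place-< {n} d = subst (_< n) (sym (place≡toℕ-opposite d)) (toℕ<n (opposite d))

place-injective : ∀ {n} {d d′ : Fin n} → place d ≡ place d′ → d ≡ d′
place-injective {d = d} {d′} eq = toℕ-injective (suc-injective (∸-cancelˡ-≡ (toℕ<n d) (toℕ<n d′) eq))

place-surjective : ∀ {n s} → s < n → Σ (Fin n) λ d → place d ≡ s
place-surjective s<n = opposite (fromℕ< s<n) ,
  trans (place≡toℕ-opposite _) (trans (cong toℕ (opposite-involutive _)) (toℕ-fromℕ< s<n))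

place-opposite-fromℕ : ∀ n → place (opposite (fromℕ n)) ≡ n
place-opposite-fromℕ n =
  trans (place≡toℕ-opposite (opposite (fromℕ n))) (trans (cong toℕ (opposite-involutive _)) (toℕ-fromℕ n))

module DigitPositions (k′ n : ℕ) where
  open Digits k′
  open Layers k n

  digit-injective : ∀ {c c′} → c < k ^ n → c′ < k ^ n → (∀ d → digit k n d c ≡ digit k n d c′) → c ≡ c′
  digit-injective {c} {c′} c< c′< same = digitAt-injective n c< c′< λ s s<n →
    let d , place-d≡s = place-surjective s<n in subst (λ t → digitAt t c ≡ digitAt t c′) place-d≡s (same d)

  fromDigits : List (Fin n) → List ℕ → ℕ
  fromDigits (d ∷ ds) (j ∷ js) = fromDigits ds js + j * k ^ place d
  fromDigits _        _        = 0

  fromDigits-outside : ∀ {ds js d} → Unique ds → All (d ≢_) ds → DigitString ds js →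
                       digit k n d (fromDigits ds js) ≡ 0
  fromDigits-outside {d = d} [] [] [] = digitAt-0≡0 (place d)
  fromDigits-outside {d′ ∷ ds} {j ∷ js} {d} (d′∉ds ∷ ds-unique) (d≢d′ ∷ d∉ds) (j<k ∷ js<k) = trans
    (digitAt-+-other (place d′) (place d) _ j (fromDigits-outside ds-unique d′∉ds js<k) j<k
                     (d≢d′ ∘ place-injective))
    (fromDigits-outside ds-unique d∉ds js<k)

  hasDigits-+-outside : ∀ {ds js d c j} → All (d ≢_) ds → digit k n d c ≡ 0 → j < k →
                        HasDigits ds js c → HasDigits ds js (c + j * k ^ place d)
  hasDigits-+-outside []            _    _   []             = []
  hasDigits-+-outside {d′ ∷ _} {d = d} {c} {j} (d≢d′ ∷ d∉ds) c-d≡0 j<k (c-d′≡j′ ∷ c-ds≡js) =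
    trans (digitAt-+-other (place d) (place d′) c j c-d≡0 j<k (d≢d′ ∘ sym ∘ place-injective)) c-d′≡j′
    ∷ hasDigits-+-outside d∉ds c-d≡0 j<k c-ds≡js

  fromDigits-hasDigits : ∀ {ds js} → Unique ds → DigitString ds js → HasDigits ds js (fromDigits ds js)
  fromDigits-hasDigits [] [] = []
  fromDigits-hasDigits {d ∷ ds} {j ∷ js} (d∉ds ∷ ds-unique) (j<k ∷ js<k) =
    digitAt-+-same (place d) _ j d-free j<k ∷ hasDigits-+-outside d∉ds d-free j<k (fromDigits-hasDigits ds-unique js<k)
    where
    d-free : digit k n d (fromDigits ds js) ≡ 0
    d-free = fromDigits-outside ds-unique d∉ds js<k

  fromDigits-< : ∀ {ds js} → Unique ds → DigitString ds js → fromDigits ds js < k ^ n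
  fromDigits-< [] [] = m^n>0 k n
  fromDigits-< {d ∷ ds} {j ∷ js} (d∉ds ∷ ds-unique) (j<k ∷ js<k) = c+j*k^e<k^n n (place d) j
    (fromDigits-< ds-unique js<k) (fromDigits-outside ds-unique d∉ds js<k) (place-< d) j<k

  hasDigits-agree : ∀ {ds js c c′ d} → HasDigits ds js c → HasDigits ds js c′ → d ∈ ds →
                    digit k n d c ≡ digit k n d c′
  hasDigits-agree (c-d≡j ∷ _)   (c′-d≡j ∷ _)   (here refl)  = trans c-d≡j (sym c′-d≡j)
  hasDigits-agree (_ ∷ c-ds≡js) (_ ∷ c′-ds≡js) (there d∈ds) = hasDigits-agree c-ds≡js c′-ds≡js d∈ds

  filter-hasDigits-all-positions : ∀ {ds js} → Unique ds → (∀ d → d ∈ ds) → DigitString ds js →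
                                   filter (hasDigits? ds js) (upTo (k ^ n)) ≡ fromDigits ds js ∷ []
  filter-hasDigits-all-positions ds-unique all-positions js<k =
    filter-upTo-unique (hasDigits? _ _) (fromDigits-< ds-unique js<k) (fromDigits-hasDigits ds-unique js<k)
      λ y< y-ds≡js → digit-injective y< (fromDigits-< ds-unique js<k) λ d →
        hasDigits-agree y-ds≡js (fromDigits-hasDigits ds-unique js<k) (all-positions d)

module LastFiring (k′ n : ℕ) (ds : List (Fin n)) (d* : Fin n)
                  (distinct : Unique (d* ∷ ds)) (all-positions : ∀ d → d ∈ d* ∷ ds) where
  open Digits k′ using (k)
  open Layers k n
  open DigitPositions k′ n
  open BlockDescents k′ (k ^ place d*) using (block)

  offsets : List ℕ
  offsets = map (fromDigits ds) (digitStrings (length ds))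

  fire-last-vertex : ∀ {js} → DigitString ds js →
                     concat (fireVertex k n d* (filter (hasDigits? ds js) (upTo (k ^ n)))) ≡ block (fromDigits ds js)
  fire-last-vertex {js} js<k = begin
    concat (map (λ j → filter (λ c → digit k n d* c ≟ j) (filter (hasDigits? ds js) U)) (upTo k))
      ≡⟨ cong concat (map-cong-local (All.tabulate λ j∈ → child (∈-upTo⁻ j∈))) ⟩
    concat (map (λ j → chip j ∷ []) (upTo k))
      ≡⟨ cong concat (map-∘ {g = [_]} {f = chip} (upTo k)) ⟩
    concat (map [_] (map chip (upTo k)))
      ≡⟨ concat-map-[ map chip (upTo k) ] ⟩
    map chip (upTo k)
      ≡⟨ map-upTo chip k ⟩
    block (fromDigits ds js)
      ∎
    where
    open ≡-Reasoning
    U = upTo (k ^ n)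
    chip : ℕ → ℕ
    chip j = fromDigits (d* ∷ ds) (j ∷ js)
    child : ∀ {j} → j < k → filter (λ c → digit k n d* c ≟ j) (filter (hasDigits? ds js) U) ≡ chip j ∷ []
    child {j} j<k = trans (filter-hasDigits-digit d* j ds js U)
                          (filter-hasDigits-all-positions distinct all-positions (j<k ∷ js<k))

  stable-blocks : concat (runLayers k n (ds ∷ʳ d*) (upTo (k ^ n) ∷ [])) ≡ concat (map block offsets)
  stable-blocks = begin
    concat (runLayers k n (ds ∷ʳ d*) (U ∷ []))
      ≡⟨ cong concat (runLayers-∷ʳ ds d* (U ∷ [])) ⟩
    concat (concatMap (fireVertex k n d*) (runLayers k n ds (U ∷ [])))
      ≡⟨ cong (concat ∘ concatMap (fireVertex k n d*)) (runLayers-single-vertex ds U) ⟩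
    concat (concatMap (fireVertex k n d*) (map vertex strings))
      ≡⟨ concat-concat (map (fireVertex k n d*) (map vertex strings)) ⟨
    concat (map concat (map (fireVertex k n d*) (map vertex strings)))
      ≡⟨ cong concat (trans (sym (map-∘ (map vertex strings))) (sym (map-∘ strings))) ⟩
    concat (map (λ js → concat (fireVertex k n d* (vertex js))) strings)
      ≡⟨ cong concat (map-cong-local (All.map fire-last-vertex (digitStrings-valid ds))) ⟩
    concat (map (block ∘ fromDigits ds) strings)
      ≡⟨ cong concat (map-∘ strings) ⟩
    concat (map block offsets)
      ∎
    where
    open ≡-Reasoning
    U = upTo (k ^ n)
    strings = digitStrings (length ds)
    vertex : List ℕ → List ℕ
    vertex js = filter (hasDigits? ds js) U

  length-offsets : length offsets ≡ k ^ length ds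
  length-offsets = trans (length-map (fromDigits ds) (digitStrings (length ds))) (length-digitStrings (length ds))

  offsets-<∧last-digit≡0 : All (λ a → a < k ^ n × digit k n d* a ≡ 0) offsets
  offsets-<∧last-digit≡0 = All.map⁺ (All.map
    (λ js<k → fromDigits-< ds-unique js<k , fromDigits-outside ds-unique d*∉ds js<k) (digitStrings-valid ds))
    where
    d*∉ds : All (d* ≢_) ds
    d*∉ds = AllPairs.head distinct
    ds-unique : Unique ds
    ds-unique = AllPairs.tail distinct

tabulate-∷ʳ : ∀ {a} {A : Set a} {m} (f : Fin (suc m) → A) →
              tabulate f ≡ tabulate (f ∘ inject₁) ∷ʳ f (fromℕ m)
tabulate-∷ʳ {m = zero}  f = refl
tabulate-∷ʳ {m = suc m} f = cong (f Fin.zero ∷_) (tabulate-∷ʳ (f ∘ Fin.suc))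

fromℕ-or-inject₁ : ∀ {m} (i : Fin (suc m)) → i ≡ fromℕ m ⊎ Σ (Fin m) λ i′ → i ≡ inject₁ i′
fromℕ-or-inject₁ {m} i with m ≟ toℕ i
... | yes m≡i = inj₁ (toℕ-injective (trans (sym m≡i) (sym (toℕ-fromℕ m))))
... | no  m≢i = inj₂ (lower₁ i m≢i , sym (inject₁-lower₁ i m≢i))

m<n⇒m*o≤o*n∸o : ∀ {m n} o → m < n → m * o ≤ o * n ∸ o
m<n⇒m*o≤o*n∸o {m} {n} o m<n = m+n≤o⇒m≤o∸n (m * o) (begin
  m * o + o ≡⟨ +-comm (m * o) o ⟩
  suc m * o ≤⟨ *-monoˡ-≤ o m<n ⟩
  n * o     ≡⟨ *-comm n o ⟩
  o * n     ∎)
  where open ≤-Reasoning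

m*o≤o*n∸o⇒m<n : ∀ {m n} o .{{_ : NonZero o}} → 0 < n → m * o ≤ o * n ∸ o → m < n
m*o≤o*n∸o⇒m<n {m} {n} o 0<n m*o≤ = *-cancelʳ-≤ (suc m) n o (begin
  suc m * o     ≡⟨ +-comm o (m * o) ⟩
  m * o + o     ≤⟨ +-monoˡ-≤ o m*o≤ ⟩
  o * n ∸ o + o ≡⟨ m∸n+n≡m (m≤m*n o n {{>-nonZero 0<n}}) ⟩
  o * n         ≡⟨ *-comm o n ⟩
  n * o         ∎)
  where open ≤-Reasoning

module FiringOrder (k′ n′ : ℕ) (w : Sym (suc n′)) where
  open Digits k′ using (k; digitAt; top-digitAt≡0⇒c<k^n)

  earlyPositions : List (Fin (suc n′))
  earlyPositions = tabulate (λ i → w ⟨$⟩ʳ inject₁ i)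

  lastPosition : Fin (suc n′)
  lastPosition = w ⟨$⟩ʳ fromℕ n′

  distinct : Unique (lastPosition ∷ earlyPositions)
  distinct = All.tabulate⁺ (λ i → fromℕ≢inject₁ ∘ Injection.injective (↔⇒↣ w))
           ∷ Unique.tabulate⁺ (inject₁-injective ∘ Injection.injective (↔⇒↣ w))

  all-positions : ∀ d → d ∈ lastPosition ∷ earlyPositions
  all-positions d with fromℕ-or-inject₁ (w ⟨$⟩ˡ d)
  ... | inj₁ w⁻¹d≡n′      = here (trans (sym (inverseʳ w)) (cong (w ⟨$⟩ʳ_) w⁻¹d≡n′))
  ... | inj₂ (i , w⁻¹d≡i) =
    there (subst (_∈ earlyPositions) (trans (cong (w ⟨$⟩ʳ_) (sym w⁻¹d≡i)) (inverseʳ w)) (∈-tabulate⁺ i))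

  open LastFiring k′ (suc n′) earlyPositions lastPosition distinct all-positions
  open BlockDescents k′ (k ^ place lastPosition) using (block; descent⇒block-boundary; block-boundary⇒descent)

  config-blocks : config k (suc n′) w ≡ concat (map block offsets)
  config-blocks = trans (cong (λ ds → concat (runLayers k (suc n′) ds (upTo (k ^ suc n′) ∷ [])))
                              (trans (map-tabulate id (w ⟨$⟩ʳ_)) (tabulate-∷ʳ (w ⟨$⟩ʳ_))))
                        stable-blocks

  length-offsets′ : length offsets ≡ k ^ n′
  length-offsets′ = trans length-offsets (cong (k ^_) (length-tabulate (λ i → w ⟨$⟩ʳ inject₁ i)))

  descent⇒multiple : ∀ {i} → IsDescent (config k (suc n′) w) i →
                     Σ ℕ λ m → (1 ≤ m) × (i ≡ m * k) × (i ≤ k ^ suc n′ ∸ k)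
  descent⇒multiple {i} desc =
    let m , 1≤m , m<len , i≡mk = descent⇒block-boundary offsets i (subst (λ π → IsDescent π i) config-blocks desc)
    in m , 1≤m , i≡mk ,
       subst (_≤ k ^ suc n′ ∸ k) (sym i≡mk) (m<n⇒m*o≤o*n∸o k (subst (m <_) length-offsets′ m<len))

  multiple⇒descent : 1 ≤ k′ → place lastPosition ≡ n′ → ∀ {m} → 1 ≤ m → m * k ≤ k ^ suc n′ ∸ k →
                     IsDescent (config k (suc n′) w) (m * k)
  multiple⇒descent 1≤k′ last-is-top {m} 1≤m bound = subst (λ π → IsDescent π (m * k)) (sym config-blocks)
    (block-boundary⇒descent 1≤k′ offsets m (All.map below-top offsets-<∧last-digit≡0) 1≤m
      (subst (m <_) (sym length-offsets′) (m*o≤o*n∸o⇒m<n k (m^n>0 k n′) bound)))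
    where
    below-top : ∀ {a} → a < k ^ suc n′ × digit k (suc n′) lastPosition a ≡ 0 → a < k ^ place lastPosition
    below-top {a} (a< , a-last≡0) = subst (λ s → a < k ^ s) (sym last-is-top)
      (top-digitAt≡0⇒c<k^n n′ a< (subst (λ s → digitAt s a ≡ 0) last-is-top a-last≡0))

singleton-no-descent : ∀ x i → ¬ IsDescent (x ∷ []) i
singleton-no-descent x (suc i) (_ , _ , _ , () , _)

corollary5p2 : (k n : ℕ) → 2 ≤ k → (i : ℕ) →
    (Σ (Sym n) λ w → IsDescent (config k n w) i) ⇔ (Σ ℕ λ m → (1 ≤ m) × (i ≡ m * k) × (i ≤ k ^ n ∸ k))
corollary5p2 (suc (suc k″)) zero     (s≤s (s≤s z≤n)) i = mk⇔
  (λ (_ , desc) → contradiction desc (singleton-no-descent 0 i))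
  λ { (suc _ , _ , refl , ()) }
corollary5p2 (suc (suc k″)) (suc n′) (s≤s (s≤s z≤n)) i = mk⇔
  (λ (w , desc) → FiringOrder.descent⇒multiple (suc k″) n′ w desc)
  λ { (m , 1≤m , refl , bound) → reverse ,
        FiringOrder.multiple⇒descent (suc k″) n′ reverse (s≤s z≤n) (place-opposite-fromℕ n′) 1≤m bound }
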